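{- Let $\varrho$ be the substitution $\varrho({\tt a})={\tt a}{\tt a}{\tt b}$, $\varrho({\tt b})={\tt a}{\tt b}$. Write the Fibonacci word ${\tt f}=f_0f_1f_2\cdots$ as the concatenation of level-$2$ supertiles ${\tt f}=\varrho_F^2(f_0)\varrho_F^2(f_1)\varrho_F^2(f_2)\cdots$, where $\varrho_F^2({\tt a})={\tt a}{\tt b}{\tt a}$ and $\varrho_F^2({\tt b})={\tt a}{\tt b}$. Let ${\tt w}$ be the word obtained by replacing each supertile ${\tt a}{\tt b}{\tt a}=\varrho_F^2({\tt a})$ by $\varrho({\tt a})={\tt a}{\tt a}{\tt b}$ and keeping each supertile ${\tt a}{\tt b}=\varrho_F^2({\tt b})=\varrho({\tt b})$ unchanged. Then ${\tt w}=\varrho({\tt f})=D({\tt f})$.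
   Context: The Fibonacci word ${\tt f}$ is the fixed point of $\varrho_F:{\tt a}\mapsto{\tt a}{\tt b},\ {\tt b}\mapsto{\tt a}$ (so ${\tt f}=\varrho_F^2({\tt f})$). $D$ deletes the first occurrence of ${\tt a}$ and the first occurrence of ${\tt b}$ in a word. -}

module Defs where

open import Data.Nat using (ℕ; zero; suc; _<_; _<ᵇ_; _⊔_; _⊓_)
open import Data.Bool using (if_then_else_)
open import Data.List using (List; []; _∷_; concatMap; applyUpTo)
open import Data.Product using (∃; ∃-syntax; _×_)
open import Relation.Binary.PropositionalEquality using (_≡_; _≢_)
open import Function using (_∘_)

data Letter : Set where
  a b : Letter

Word : Set
Word = List Letter

InfWord : Set
InfWord = ℕ → Letter

-- lookup with default (only used at indices known to be in range)
at : Word → ℕ → Letter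
at []       _       = a
at (x ∷ xs) zero    = x
at (x ∷ xs) (suc n) = at xs n

substW : (Letter → Word) → Word → Word
substW σ = concatMap σ

iterate : {A : Set} → (A → A) → ℕ → A → A
iterate g zero    x = x
iterate g (suc n) x = g (iterate g n x)

-- image of an infinite word under a substitution σ with nonempty images:
-- letter n of σ(u) is letter n of σ(u₀ … uₙ) (which has length ≥ n+1).
substI : (Letter → Word) → InfWord → InfWord
substI σ u n = at (substW σ (applyUpTo u (suc n))) n

ρF : Letter → Word
ρF a = a ∷ b ∷ []
ρF b = a ∷ []

ρF² : Letter → Word
ρF² x = substW ρF (ρF x)

ρ : Letter → Word
ρ a = a ∷ a ∷ b ∷ []
ρ b = a ∷ b ∷ []

-- Fibonacci word: the fixed point of ρ_F, letter n read off ρ_F^{n+1}(a)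
-- (which has length ≥ n+1 and is a prefix of the fixed point)
fib : InfWord
fib n = at (iterate (substW ρF) (suc n) (a ∷ [])) n

replaceTile : Word → Word
replaceTile (a ∷ b ∷ a ∷ []) = a ∷ a ∷ b ∷ []
replaceTile xs               = xs

w : InfWord
w = substI (replaceTile ∘ ρF²) fib

FirstOcc : InfWord → Letter → ℕ → Set
FirstOcc u x i = (u i ≡ x) × (∀ k → k < i → u k ≢ x)

remove1 : InfWord → ℕ → InfWord
remove1 u i n = if n <ᵇ i then u n else u (suc n)

IsD : InfWord → InfWord → Set
IsD u v = ∃[ i ] ∃[ j ] (FirstOcc u a i × FirstOcc u b j
            × (∀ n → v n ≡ remove1 (remove1 u (i ⊔ j)) (i ⊓ j) n))

-- The substitution ρ is conjugate to ρ_F² by the word ab: ab·ρ(u) = ρ_F²(u)·ab for every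
-- finite word u. Since f = ρ_F²(f), applying this to longer and longer prefixes of f shows
-- that ρ(f) is f shifted by two letters; and as f begins with ab, the shift by two is D(f).
-- The equality w = ρ(f) holds because replacing the supertile aba by aab turns ρ_F² into ρ
-- letter by letter.
{-# OPTIONS --safe #-}
module Submission where

open import Defs
open import Data.Nat using (ℕ; zero; suc; _+_; _≤_; _<_; _≤′_; ≤′-refl; ≤′-step; z≤n; s≤s; s≤s⁻¹)
open import Data.Nat.Properties using (≤-refl; ≤-reflexive; ≤-trans; +-mono-≤; m≤n+m; ≤⇒≤′; module ≤-Reasoning)
open import Data.List using ([]; _∷_; _++_; length; applyUpTo)
open import Data.List.Properties using (++-assoc; ++-identityʳ; length-++; length-applyUpTo; concatMap-++; concatMap-cong)
open import Data.Product using (∃; _×_; _,_)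
open import Function using (_∘_)
open import Relation.Binary.PropositionalEquality using (_≡_; refl; sym; trans; cong; cong₂; module ≡-Reasoning)

substW-∘ : ∀ σ τ u → substW (substW τ ∘ σ) u ≡ substW τ (substW σ u)
substW-∘ σ τ []      = refl
substW-∘ σ τ (x ∷ u) =
  trans (cong (substW τ (σ x) ++_) (substW-∘ σ τ u)) (sym (concatMap-++ τ (σ x) (substW σ u)))

NonErasing : (Letter → Word) → Set
NonErasing σ = ∀ x → 0 < length (σ x)

length-substW-≥ : ∀ {σ} → NonErasing σ → ∀ u → length u ≤ length (substW σ u)
length-substW-≥ ne []               = z≤n
length-substW-≥ {σ} ne (x ∷ u) rewrite length-++ (σ x) {substW σ u} =
  +-mono-≤ (ne x) (length-substW-≥ ne u)

at-++ˡ : ∀ (xs ys : Word) {k} → k < length xs → at (xs ++ ys) k ≡ at xs k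
at-++ˡ (x ∷ xs) ys {zero}  _         = refl
at-++ˡ (x ∷ xs) ys {suc k} (s≤s k<) = at-++ˡ xs ys k<

infix 4 _≼_

_≼_ : Word → Word → Set
xs ≼ ys = ∃ λ zs → xs ++ zs ≡ ys

≼-refl : ∀ {xs} → xs ≼ xs
≼-refl {xs} = [] , ++-identityʳ xs

≼-trans : ∀ {xs ys zs} → xs ≼ ys → ys ≼ zs → xs ≼ zs
≼-trans {xs} (us , refl) (vs , refl) = us ++ vs , sym (++-assoc xs us vs)

substW-≼ : ∀ σ {xs ys} → xs ≼ ys → substW σ xs ≼ substW σ ys
substW-≼ σ {xs} (zs , refl) = substW σ zs , sym (concatMap-++ σ xs zs)

at-≼ : ∀ {xs ys k} → xs ≼ ys → k < length xs → at xs k ≡ at ys k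
at-≼ {xs} (zs , refl) k< = sym (at-++ˡ xs zs k<)

applyUpTo-≼ : ∀ m (u : InfWord) ys → m ≤ length ys → (∀ k → k < m → u k ≡ at ys k) →
              applyUpTo u m ≼ ys
applyUpTo-≼ zero    u ys       _       _     = ys , refl
applyUpTo-≼ (suc m) u (y ∷ ys) (s≤s m≤) agree =
  let zs , eq = applyUpTo-≼ m (u ∘ suc) ys m≤ (λ k → agree (suc k) ∘ s≤s)
  in  zs , cong₂ _∷_ (agree zero (s≤s z≤n)) eq

substI-cong : ∀ {σ τ} → (∀ x → σ x ≡ τ x) → ∀ u n → substI σ u n ≡ substI τ u n
substI-cong σ≗τ u n = cong (λ v → at v n) (concatMap-cong σ≗τ (applyUpTo u (suc n)))

substI-via-prefix : ∀ {σ} → NonErasing σ → ∀ (u : InfWord) xs n → n < length xs →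
                    (∀ k → k ≤ n → u k ≡ at xs k) → substI σ u n ≡ at (substW σ xs) n
substI-via-prefix {σ} ne u xs n n< agree =
  at-≼ (substW-≼ σ (applyUpTo-≼ (suc n) u xs n< (λ k → agree k ∘ s≤s⁻¹))) n<length
  where
  n<length : n < length (substW σ (applyUpTo u (suc n)))
  n<length = ≤-trans (≤-reflexive (sym (length-applyUpTo u (suc n))))
                     (length-substW-≥ {σ} ne (applyUpTo u (suc n)))

fibPrefix : ℕ → Word
fibPrefix k = iterate (substW ρF) k (a ∷ [])

fibPrefix-++ : ∀ k → fibPrefix (2 + k) ≡ fibPrefix (1 + k) ++ fibPrefix k
fibPrefix-++ zero    = refl
fibPrefix-++ (suc k) =
  trans (cong (substW ρF) (fibPrefix-++ k)) (concatMap-++ ρF (fibPrefix (suc k)) (fibPrefix k))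

fibPrefix-≼-suc : ∀ k → fibPrefix k ≼ fibPrefix (suc k)
fibPrefix-≼-suc zero    = b ∷ [] , refl
fibPrefix-≼-suc (suc k) = fibPrefix k , sym (fibPrefix-++ k)

fibPrefix-≼ : ∀ {j m} → j ≤ m → fibPrefix j ≼ fibPrefix m
fibPrefix-≼ j≤m = go (≤⇒≤′ j≤m)
  where
  go : ∀ {j m} → j ≤′ m → fibPrefix j ≼ fibPrefix m
  go ≤′-refl                 = ≼-refl
  go {m = suc m} (≤′-step p) = ≼-trans (go p) (fibPrefix-≼-suc m)

length-fibPrefix : ∀ k → k < length (fibPrefix k)
length-fibPrefix zero          = s≤s z≤n
length-fibPrefix (suc zero)    = s≤s (s≤s z≤n)
length-fibPrefix (suc (suc k)) = begin-strict
  2 + k                                             <⟨ s≤s (s≤s (m≤n+m (suc k) k)) ⟩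
  suc (suc k) + suc k                               ≤⟨ +-mono-≤ (length-fibPrefix (suc k)) (length-fibPrefix k) ⟩
  length (fibPrefix (1 + k)) + length (fibPrefix k) ≡⟨ sym (length-++ (fibPrefix (1 + k))) ⟩
  length (fibPrefix (1 + k) ++ fibPrefix k)         ≡⟨ cong length (sym (fibPrefix-++ k)) ⟩
  length (fibPrefix (2 + k))                        ∎
  where open ≤-Reasoning

fib-at-fibPrefix : ∀ {k m} → k ≤ m → fib k ≡ at (fibPrefix m) k
fib-at-fibPrefix {k} {m} k≤m = begin
  at (fibPrefix (suc k)) k ≡⟨ sym (at-≼ (fibPrefix-≼-suc k) (length-fibPrefix k)) ⟩
  at (fibPrefix k) k       ≡⟨ at-≼ (fibPrefix-≼ k≤m) (length-fibPrefix k) ⟩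
  at (fibPrefix m) k       ∎
  where open ≡-Reasoning

ab-ρ≡ρF²-ab : ∀ u → (a ∷ b ∷ []) ++ substW ρ u ≡ substW ρF² u ++ (a ∷ b ∷ [])
ab-ρ≡ρF²-ab []      = refl
ab-ρ≡ρF²-ab (a ∷ u) = cong (λ v → a ∷ b ∷ a ∷ v) (ab-ρ≡ρF²-ab u)
ab-ρ≡ρF²-ab (b ∷ u) = cong (λ v → a ∷ b ∷ v) (ab-ρ≡ρF²-ab u)

ρ-nonErasing : NonErasing ρ
ρ-nonErasing a = s≤s z≤n
ρ-nonErasing b = s≤s z≤n

substI-ρ-fib : ∀ n → substI ρ fib n ≡ fib (2 + n)
substI-ρ-fib n = begin
  substI ρ fib n
    ≡⟨ substI-via-prefix ρ-nonErasing fib (fibPrefix n) n (length-fibPrefix n) (λ _ → fib-at-fibPrefix) ⟩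
  at (ab ++ substW ρ (fibPrefix n)) (2 + n)
    ≡⟨ cong (λ v → at v (2 + n)) (ab-ρ≡ρF²-ab (fibPrefix n)) ⟩
  at (substW ρF² (fibPrefix n) ++ ab) (2 + n)
    ≡⟨ cong (λ v → at (v ++ ab) (2 + n)) (substW-∘ ρF ρF (fibPrefix n)) ⟩
  at (fibPrefix (2 + n) ++ ab) (2 + n)
    ≡⟨ at-++ˡ (fibPrefix (2 + n)) ab (length-fibPrefix (2 + n)) ⟩
  at (fibPrefix (2 + n)) (2 + n)
    ≡⟨ sym (fib-at-fibPrefix {2 + n} ≤-refl) ⟩
  fib (2 + n) ∎
  where
  open ≡-Reasoning
  ab : Word
  ab = a ∷ b ∷ []

replaceTile-ρF² : ∀ x → replaceTile (ρF² x) ≡ ρ x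
replaceTile-ρF² a = refl
replaceTile-ρF² b = refl

theorem4p9 : ((n : ℕ) → w n ≡ substI ρ fib n) × IsD fib (substI ρ fib)
-- Deleting positions 0 and 1 of fib is, by computation, the shift by two.
theorem4p9 = substI-cong replaceTile-ρF² fib , 0 , 1 , firstOcc-a , firstOcc-b , substI-ρ-fib
  where
  firstOcc-a : FirstOcc fib a 0
  firstOcc-a = refl , λ _ ()

  firstOcc-b : FirstOcc fib b 1
  firstOcc-b = refl , λ { zero _ () ; (suc _) (s≤s ()) }
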